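{- For every graph $G$ and every integer $d\geq 2$, $$\chi(G^d)\leq\begin{cases}\omega(G^d)^2 & \text{if } d \text{ is even},\\ \omega(G^d)^3 & \text{if } d\text{ is odd}.\end{cases}$$
   Context: All graphs are finite, simple and undirected. $G^d$ is the graph on $V(G)$ where distinct $u,v$ are adjacent iff their distance in $G$ is at most $d$. $\chi$ denotes chromatic number and $\omega$ clique number. -}

module Defs where

open import Data.Nat using (ℕ; zero; suc; _≤_)
open import Data.Fin using (Fin)
open import Data.Product using (Σ; _×_; ∃; _,_)
open import Relation.Nullary using (¬_)
open import Relation.Binary.PropositionalEquality using (_≡_)
open import Function.Definitions using (Injective)
open import Level using (0ℓ)
open import Relation.Binary.PropositionalEquality using () renaming (sym to symm; refl to reflx)
open import Data.Nat using (_*_)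

record Graph (n : ℕ) : Set₁ where
  field
    Adj   : Fin n → Fin n → Set
    sym   : ∀ {u v} → Adj u v → Adj v u
    irrefl : ∀ {u} → ¬ Adj u u
open Graph public

data Walk {n : ℕ} (G : Graph n) : Fin n → Fin n → ℕ → Set where
  here : ∀ {u} → Walk G u u zero
  step : ∀ {u v w ℓ} → Adj G u v → Walk G v w ℓ → Walk G u w (suc ℓ)

DistLe : {n : ℕ} → Graph n → ℕ → Fin n → Fin n → Set
DistLe G d u v = Σ ℕ λ ℓ → (ℓ ≤ d) × Walk G u v ℓ

power : {n : ℕ} → Graph n → ℕ → Graph n
power {n} G d = record
  { Adj = λ u v → ¬ (u ≡ v) × DistLe G d u v
  ; sym = λ { (u≢v , ℓ , ℓ≤d , w) → (λ e → u≢v (symm e)) , ℓ , ℓ≤d , rev w }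
  ; irrefl = λ { (u≢u , _) → u≢u reflx }
  }
  where
  snoc : ∀ {u v w ℓ} → Walk G u v ℓ → Adj G v w → Walk G u w (suc ℓ)
  snoc here a = step a here
  snoc (step a p) b = step a (snoc p b)
  rev : ∀ {u v ℓ} → Walk G u v ℓ → Walk G v u ℓ
  rev here = here
  rev (step a p) = snoc (rev p) (Graph.sym G a)

Colouring : {n : ℕ} → Graph n → ℕ → Set
Colouring {n} G k = Σ (Fin n → Fin k) λ c → ∀ u v → Adj G u v → ¬ (c u ≡ c v)

Colourable : {n : ℕ} → Graph n → ℕ → Set
Colourable G k = Colouring G k

IsChromaticNumber : {n : ℕ} → Graph n → ℕ → Set
IsChromaticNumber G k = Colourable G k × (∀ j → Colourable G j → k ≤ j)

Clique : {n : ℕ} → Graph n → ℕ → Set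
Clique {n} G k = Σ (Fin k → Fin n) λ f →
  Injective _≡_ _≡_ f × (∀ i j → ¬ (i ≡ j) → Adj G (f i) (f j))

IsCliqueNumber : {n : ℕ} → Graph n → ℕ → Set
IsCliqueNumber G k = Clique G k × (∀ j → Clique G j → j ≤ k)

IsEven : ℕ → Set
IsEven d = Σ ℕ λ k → d ≡ 2 * k

IsOdd : ℕ → Set
IsOdd d = Σ ℕ λ k → d ≡ suc (2 * k)

-- Write B_r(v) for the ball of radius r in G. If 2r ≤ d, any two vertices of B_r(v) are at
-- distance at most d, so B_r(v) is a clique of G^d and has at most ω vertices. Since
-- B_{r+s}(v) ⊆ ⋃_{u ∈ B_r(v)} B_s(u), the closed neighbourhood B_d(v) of v in G^d has at most
-- ω·ω vertices when d = 2k, and at most ω·ω·ω when d = 2k+1 ≤ (1 + k) + k, where the radius-1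
-- balls are cliques because d ≥ 2. Greedy colouring then needs no more colours than that.
-- Set sizes are bounded by listings Fin K → V rather than counted.

module Submission where

open import Defs hiding (sym)
open import Data.Nat using (ℕ; zero; suc; _≤_; _<_; _^_; _+_; _*_; z≤n; s≤s; _≤′_; ≤′-refl; ≤′-step; _≤?_)
open import Data.Nat.Properties using (≤⇒≤′; m≤n⇒m≤1+n; ≤-refl; <⇒≱; n<1+n; ≤-trans; ≤-reflexive; +-mono-≤; +-identityʳ; *-identityʳ; *-assoc)
open import Data.Fin using (Fin; zero; suc; _≟_; combine; remQuot; punchIn; punchOut)
open import Data.Fin.Properties using (any?; all?; ¬∀⟶∃¬; injective⇒≤; 0≢1+n; remQuot-combine; punchIn-punchOut)
open import Data.Vec.Functional using (_∷_)
open import Data.List using (List; filter; allFin; lookup; length)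
import Data.List.Relation.Unary.All as All
import Data.List.Relation.Unary.AllPairs as AllPairs
open import Data.List.Relation.Unary.Any using (index)
open import Data.List.Relation.Unary.Any.Properties using (lookup-index)
open import Data.List.Relation.Unary.Unique.Propositional using (Unique)
open import Data.List.Relation.Unary.Unique.Propositional.Properties using (allFin⁺; filter⁺)
open import Data.List.Membership.Propositional.Properties using (∈-lookup; ∈-filter⁺; ∈-filter⁻; ∈-allFin)
open import Data.Empty using (⊥-elim)
open import Data.Product using (Σ; _×_; _,_; ∃; proj₁; proj₂; uncurry)
open import Data.Sum using (_⊎_; inj₁; inj₂)
import Data.Sum as Sum
open import Function using (_∘_; id)
open import Function.Definitions using (Injective)
open import Relation.Nullary using (¬_; Dec; yes; no; ¬?; contradiction)
open import Relation.Nullary.Decidable using (decidable-stable; map′; _⊎-dec_; _×-dec_; ¬¬-excluded-middle)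
open import Relation.Unary using (Pred; _⊆_; Decidable)
open import Relation.Binary.PropositionalEquality using (_≡_; _≢_; refl; sym; trans; cong; subst)
open import Level using (0ℓ)

Covers : {A : Set} → ℕ → Pred A 0ℓ → Set
Covers {A} K S = Σ (Fin K → A) λ f → S ⊆ λ x → ∃ λ i → f i ≡ x

module _ {A : Set} where

  covers-⊆ : ∀ {K} {S T : Pred A 0ℓ} → S ⊆ T → Covers K T → Covers K S
  covers-⊆ S⊆T (f , cover) = f , cover ∘ S⊆T

  covers-≤′ : ∀ {m M} {S : Pred A 0ℓ} → m ≤′ M → A → Covers m S → Covers M S
  covers-≤′ ≤′-refl a c = c
  covers-≤′ (≤′-step m≤′M) a c with f , cover ← covers-≤′ m≤′M a c =
    (a ∷ f) , λ s → let i , fi≡x = cover s in suc i , fi≡x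

  covers-≤ : ∀ {m M} {S : Pred A 0ℓ} → m ≤ M → A → Covers m S → Covers M S
  covers-≤ = covers-≤′ ∘ ≤⇒≤′

  covers-⋃ : ∀ {a b} {S R : Pred A 0ℓ} {T : A → Pred A 0ℓ} →
    Covers a S → (∀ u → Covers b (T u)) → R ⊆ (λ x → ∃ λ u → S u × T u x) →
    Covers (a * b) R
  covers-⋃ {a} {b} {R = R} (f , coverS) coverT R⊆⋃ = g , cover
    where
    h : Fin a → Fin b → A
    h i = proj₁ (coverT (f i))
    g : Fin (a * b) → A
    g = uncurry h ∘ remQuot b
    cover : R ⊆ λ x → ∃ λ k → g k ≡ x
    cover r with _ , su , tux ← R⊆⋃ r with i , refl ← coverS su
            with j , hij≡x ← proj₂ (coverT (f i)) tux =
      combine i j , trans (cong (uncurry h) (remQuot-combine i j)) hij≡x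

free-colour : ∀ {m K} → m < K → (g : Fin m → Fin K) → ∃ λ c → ∀ i → g i ≢ c
free-colour {m} m<K g with any? (λ c → all? (λ i → ¬? (g i ≟ c)))
... | yes found = found
... | no none = contradiction (injective⇒≤ preimage-injective) (<⇒≱ m<K)
  where
  hit : ∀ c → ∃ λ i → g i ≡ c
  hit c = let i , ¬gi≢c = ¬∀⟶∃¬ m _ (λ i → ¬? (g i ≟ c)) (λ avoids → none (c , avoids))
          in i , decidable-stable (g i ≟ c) ¬gi≢c
  preimage-injective : Injective _≡_ _≡_ (proj₁ ∘ hit)
  preimage-injective {c} {c′} e = trans (sym (proj₂ (hit c))) (trans (cong g e) (proj₂ (hit c′)))

free-colour-except : ∀ {K} (g : Fin K → Fin K) (i₀ : Fin K) → ∃ λ c → ∀ i → i ≢ i₀ → g i ≢ c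
free-colour-except {suc K} g i₀ with c , avoids ← free-colour (n<1+n K) (g ∘ punchIn i₀) =
  c , λ i i≢i₀ gi≡c → avoids (punchOut (i≢i₀ ∘ sym))
                        (trans (cong g (punchIn-punchOut (i≢i₀ ∘ sym))) gi≡c)

lookup-injective : ∀ {A : Set} {xs : List A} → Unique xs → Injective _≡_ _≡_ (lookup xs)
lookup-injective (x∉xs AllPairs.∷ _) {zero} {zero} _ = refl
lookup-injective (x∉xs AllPairs.∷ _) {zero} {suc j} x≡xsⱼ =
  contradiction x≡xsⱼ (All.lookup x∉xs (∈-lookup j))
lookup-injective (x∉xs AllPairs.∷ _) {suc i} {zero} xsᵢ≡x =
  contradiction (sym xsᵢ≡x) (All.lookup x∉xs (∈-lookup i))
lookup-injective (_ AllPairs.∷ unique) {suc i} {suc j} e = cong suc (lookup-injective unique e)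

module _ {n : ℕ} (H : Graph n) where

  clique-covers : ∀ {ω} {S : Pred (Fin n) 0ℓ} → Decidable S →
    (∀ {x y} → S x → S y → x ≢ y → Adj H x y) → (∀ j → Clique H j → j ≤ ω) →
    Fin n → Covers ω S
  clique-covers {S = S} S? S-clique ω-max v =
    covers-≤ (ω-max (length members) (f , f-injective , f-clique)) v (f , cover)
    where
    members : List (Fin n)
    members = filter S? (allFin n)
    f : Fin (length members) → Fin n
    f = lookup members
    f-injective : Injective _≡_ _≡_ f
    f-injective = lookup-injective (filter⁺ S? (allFin⁺ n))
    member : ∀ i → S (f i)
    member i = proj₂ (∈-filter⁻ S? {xs = allFin n} (∈-lookup i))
    f-clique : ∀ i j → i ≢ j → Adj H (f i) (f j)
    f-clique i j i≢j = S-clique (member i) (member j) (i≢j ∘ f-injective)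
    cover : S ⊆ λ x → ∃ λ i → f i ≡ x
    cover {x} s = let x∈ = ∈-filter⁺ S? (∈-allFin x) s in index x∈ , sym (lookup-index x∈)

ClosedNbhd : ∀ {n} → Graph n → Fin n → Pred (Fin n) 0ℓ
ClosedNbhd H v u = u ≡ v ⊎ Adj H v u

induced-suc : ∀ {n} → Graph (suc n) → Graph n
induced-suc H = record { Adj = λ u v → Adj H (suc u) (suc v) ; sym = Graph.sym H ; irrefl = irrefl H }

covers-∘suc : ∀ {n K} {S : Pred (Fin (suc n)) 0ℓ} → Fin n → Covers K S → Covers K (S ∘ suc)
covers-∘suc v (f , cover) = (v ∷ id) ∘ f , λ s → let i , fi≡x = cover s in i , cong (v ∷ id) fi≡x

greedy-colouring : ∀ {n K} (H : Graph n) → (∀ v → Covers K (ClosedNbhd H v)) → Colouring H K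
greedy-colouring {zero} H _ = (λ ()) , λ ()
greedy-colouring {suc n} H cover
  with c′ , proper′ ← greedy-colouring (induced-suc H) (λ v →
         covers-⊆ (Sum.map (cong suc) id) (covers-∘suc v (cover (suc v))))
  with f , cover₀ ← cover zero
  with i₀ , fi₀≡0 ← cover₀ (inj₁ refl)
  -- i₀ also serves as a placeholder colour for vertex zero: index i₀ is exempt from avoidance
  with col , avoids ← free-colour-except ((i₀ ∷ c′) ∘ f) i₀ = col ∷ c′ , proper
  where
  col-fresh : ∀ v → Adj H zero (suc v) → col ≢ c′ v
  col-fresh v a col≡c′v with i , fi≡sv ← cover₀ (inj₂ a) =
    avoids i (λ { refl → 0≢1+n (trans (sym fi₀≡0) fi≡sv) })
             (trans (cong (i₀ ∷ c′) fi≡sv) (sym col≡c′v))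
  proper : ∀ u v → Adj H u v → (col ∷ c′) u ≢ (col ∷ c′) v
  proper zero zero a = ⊥-elim (irrefl H a)
  proper zero (suc v) a = col-fresh v a
  proper (suc u) zero a = col-fresh u (Graph.sym H a) ∘ sym
  proper (suc u) (suc v) a = proper′ u v a

module _ {n : ℕ} (G : Graph n) where

  Ball : ℕ → Fin n → Pred (Fin n) 0ℓ
  Ball r v = DistLe G r v

  walk-snoc : ∀ {u v w ℓ} → Walk G u v ℓ → Adj G v w → Walk G u w (suc ℓ)
  walk-snoc here a = step a here
  walk-snoc (step a p) b = step a (walk-snoc p b)

  walk-reverse : ∀ {u v ℓ} → Walk G u v ℓ → Walk G v u ℓ
  walk-reverse here = here
  walk-reverse (step a p) = walk-snoc (walk-reverse p) (Graph.sym G a)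

  walk-++ : ∀ {u v w ℓ₁ ℓ₂} → Walk G u v ℓ₁ → Walk G v w ℓ₂ → Walk G u w (ℓ₁ + ℓ₂)
  walk-++ here q = q
  walk-++ (step a p) q = step a (walk-++ p q)

  walk-split : ∀ r s {u w ℓ} → Walk G u w ℓ → ℓ ≤ r + s → ∃ λ v → DistLe G r u v × DistLe G s v w
  walk-split zero s {u} p ℓ≤s = u , (0 , z≤n , here) , (_ , ℓ≤s , p)
  walk-split (suc r) s {u} here _ = u , (0 , z≤n , here) , (0 , z≤n , here)
  walk-split (suc r) s (step a p) (s≤s ℓ≤r+s)
    with v , (ℓ₁ , ℓ₁≤r , p₁) , rest ← walk-split r s p ℓ≤r+s =
    v , (suc ℓ₁ , s≤s ℓ₁≤r , step a p₁) , rest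

  distLe-sym : ∀ {r u v} → DistLe G r u v → DistLe G r v u
  distLe-sym (ℓ , ℓ≤r , p) = ℓ , ℓ≤r , walk-reverse p

  distLe-trans : ∀ {r s u v w} → DistLe G r u v → DistLe G s v w → DistLe G (r + s) u w
  distLe-trans (ℓ₁ , ℓ₁≤r , p) (ℓ₂ , ℓ₂≤s , q) = ℓ₁ + ℓ₂ , +-mono-≤ ℓ₁≤r ℓ₂≤s , walk-++ p q

  distLe-mono : ∀ {r s u v} → r ≤ s → DistLe G r u v → DistLe G s u v
  distLe-mono r≤s (ℓ , ℓ≤r , p) = ℓ , ≤-trans ℓ≤r r≤s , p

  distLe-split : ∀ r s {u w} → DistLe G (r + s) u w → ∃ λ v → DistLe G r u v × DistLe G s v w
  distLe-split r s (ℓ , ℓ≤r+s , p) = walk-split r s p ℓ≤r+s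

  distLe? : (∀ u v → Dec (Adj G u v)) → ∀ r u v → Dec (DistLe G r u v)
  distLe? adj? zero u v = map′ (λ { refl → 0 , z≤n , here }) (λ { (0 , _ , here) → refl }) (u ≟ v)
  distLe? adj? (suc r) u v =
    map′ from-cases to-cases ((u ≟ v) ⊎-dec any? (λ w → adj? u w ×-dec distLe? adj? r w v))
    where
    from-cases : u ≡ v ⊎ (∃ λ w → Adj G u w × DistLe G r w v) → DistLe G (suc r) u v
    from-cases (inj₁ refl) = 0 , z≤n , here
    from-cases (inj₂ (w , a , ℓ , ℓ≤r , p)) = suc ℓ , s≤s ℓ≤r , step a p
    to-cases : DistLe G (suc r) u v → u ≡ v ⊎ (∃ λ w → Adj G u w × DistLe G r w v)
    to-cases (0 , _ , here) = inj₁ refl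
    to-cases (suc ℓ , s≤s ℓ≤r , step a p) = inj₂ (_ , a , ℓ , ℓ≤r , p)

  ball-covers-clique : ∀ {d ω k} → (∀ u v → Dec (Adj G u v)) → k + k ≤ d →
    (∀ j → Clique (power G d) j → j ≤ ω) → ∀ v → Covers ω (Ball k v)
  ball-covers-clique adj? k+k≤d ω-max v =
    clique-covers (power G _) (distLe? adj? _ v)
      (λ x∈ y∈ x≢y → x≢y , distLe-mono k+k≤d (distLe-trans (distLe-sym x∈) y∈)) ω-max v

  ball-covers-⋃ : ∀ {a b r s d} → (∀ v → Covers a (Ball r v)) → (∀ v → Covers b (Ball s v)) →
    d ≤ r + s → ∀ v → Covers (a * b) (Ball d v)
  ball-covers-⋃ {r = r} {s} cover-r cover-s d≤r+s v =
    covers-⋃ (cover-r v) cover-s (distLe-split r s ∘ distLe-mono d≤r+s)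

  power-colouring : ∀ {d K} → (∀ v → Covers K (Ball d v)) → Colouring (power G d) K
  power-colouring {d} cover = greedy-colouring (power G d) λ v → covers-⊆ nbhd⊆ball (cover v)
    where
    nbhd⊆ball : ∀ {v} → ClosedNbhd (power G d) v ⊆ Ball d v
    nbhd⊆ball (inj₁ refl) = 0 , z≤n , here
    nbhd⊆ball (inj₂ (_ , p)) = p

¬¬-Π-Fin : ∀ {n} {P : Fin n → Set} → (∀ i → ¬ ¬ P i) → ¬ ¬ (∀ i → P i)
¬¬-Π-Fin {zero} _ ¬all = ¬all λ ()
¬¬-Π-Fin {suc n} ¬¬P ¬all =
  ¬¬P zero λ p₀ → ¬¬-Π-Fin (¬¬P ∘ suc) λ ps → ¬all λ { zero → p₀ ; (suc i) → ps i }

-- Adjacency is only ¬¬-decidable, but a bound χ ≤ K is a decidable statement, hence ¬¬-stable.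
chromatic-bound : ∀ {n d χ K} (G : Graph n) → (∀ j → Colourable (power G d) j → χ ≤ j) →
  ((∀ u v → Dec (Adj G u v)) → ∀ v → Covers K (Ball G d v)) → χ ≤ K
chromatic-bound {χ = χ} {K} G χ-min cover = decidable-stable (χ ≤? K) λ χ≰K →
  ¬¬-Π-Fin (λ u → ¬¬-Π-Fin λ v → ¬¬-excluded-middle) λ adj? →
  χ≰K (χ-min _ (power-colouring G (cover adj?)))

n+n≡2*n : ∀ n → n + n ≡ 2 * n
n+n≡2*n n = cong (n +_) (sym (+-identityʳ n))

n*n≡n^2 : ∀ n → n * n ≡ n ^ 2
n*n≡n^2 n = cong (n *_) (sym (*-identityʳ n))

n*n*n≡n^3 : ∀ n → n * n * n ≡ n ^ 3
n*n*n≡n^3 n = trans (*-assoc n n n) (cong (n *_) (n*n≡n^2 n))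

theorem5p2 : ∀ (n : ℕ) (G : Graph n) (d : ℕ) → 2 ≤ d →
    ∀ (χ ω : ℕ) → IsChromaticNumber (power G d) χ → IsCliqueNumber (power G d) ω →
      (IsEven d → χ ≤ ω ^ 2) × (IsOdd d → χ ≤ ω ^ 3)
theorem5p2 n G d 2≤d χ ω (_ , χ-min) (_ , ω-max) = even , odd
  where
  ball : (∀ u v → Dec (Adj G u v)) → ∀ k → k + k ≤ d → ∀ v → Covers ω (Ball G k v)
  ball adj? k k+k≤d = ball-covers-clique G adj? k+k≤d ω-max

  even : IsEven d → χ ≤ ω ^ 2
  even (k , refl) = subst (χ ≤_) (n*n≡n^2 ω) (chromatic-bound G χ-min λ adj? →
    ball-covers-⋃ G (ball adj? k k+k≤d) (ball adj? k k+k≤d) (≤-reflexive (sym (n+n≡2*n k))))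
    where
    k+k≤d : k + k ≤ 2 * k
    k+k≤d = ≤-reflexive (n+n≡2*n k)

  odd : IsOdd d → χ ≤ ω ^ 3
  odd (zero , refl) = contradiction 2≤d λ { (s≤s ()) }
  odd (suc k′ , refl) = subst (χ ≤_) (n*n*n≡n^3 ω) (chromatic-bound G χ-min λ adj? →
    ball-covers-⋃ G (ball-covers-⋃ G (ball adj? 1 2≤d) (ball adj? k k+k≤d) ≤-refl) (ball adj? k k+k≤d)
      (≤-reflexive (cong suc (sym (n+n≡2*n k)))))
    where
    k : ℕ
    k = suc k′
    k+k≤d : k + k ≤ suc (2 * k)
    k+k≤d = m≤n⇒m≤1+n (≤-reflexive (n+n≡2*n k))
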